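{- Let $(\mathbb X,\otimes,K)$ be a differential category with coalgebra modality $(!,\delta,\varepsilon,\Delta,\mathsf e)$ and deriving transformation $\mathsf d$, and let $(\mathsf T,\mu,\eta,\mathsf n,\mathsf n_K)$ be a symmetric comonoidal monad on $(\mathbb X,\otimes,K)$ whose underlying endofunctor $\mathsf T$ is additive. Then the following are in bijective correspondence: (1) differential mixed distributive laws of $(\mathsf T,\mu,\eta,\mathsf n,\mathsf n_K)$ over $(!,\delta,\varepsilon,\Delta,\mathsf e,\mathsf d)$; (2) liftings of $\mathsf d$ to $(\mathbb X^{\mathsf T},\otimes^{\mathsf n},(K,\mathsf n_K))$, i.e. a lifting $(\tilde!,\tilde\delta,\tilde\varepsilon,\tilde\Delta,\tilde{\mathsf e})$ of the coalgebra modality to $(\mathbb X^{\mathsf T},\otimes^{\mathsf n},(K,\mathsf n_K))$ together with a deriving transformation $\tilde{\mathsf d}$ for it such that $U^{\mathsf T}(\tilde{\mathsf d}_{(A,\nu)})=\mathsf d_A$ for every $\mathsf T$-algebra $(A,\nu)$. Consequently, if $\lambda$ is a differential mixed distributive law of $(\mathsf T,\mu,\eta,\mathsf n,\mathsf n_K)$ over $(!,\delta,\varepsilon,\Delta,\mathsf e,\mathsf d)$, then $(\mathbb X^{\mathsf T},\otimes^{\mathsf n},(K,\mathsf n_K))$ is a differential category with the lifted coalgebra modality $(\tilde!,\tilde\delta,\tilde\varepsilon,\tilde\Delta,\tilde{\mathsf e})$ and deriving transformation $\tilde{\mathsf d}$.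
   Context: Composition is written $g\circ f$. Additive symmetric monoidal category: a symmetric monoidal category $(\mathbb X,\otimes,K)$ (associator $\alpha$, unitors $\ell,\rho$, symmetry $\sigma$) whose hom-sets are commutative monoids (sum $+$, zero $0$) with composition and $\otimes$ preserving sums and zeros in each argument. A functor $\mathsf T$ is additive if $\mathsf T(f+g)=\mathsf Tf+\mathsf Tg$ and $\mathsf T(0)=0$. Coalgebra modality $(!,\delta,\varepsilon,\Delta,\mathsf e)$: a comonad with natural $\Delta_A:!A\to!A\otimes!A$, $\mathsf e_A:!A\to K$ making each $!A$ a cocommutative comonoid with $\delta_A$ a comonoid morphism. A differential category is an additive symmetric monoidal category with a coalgebra modality and a deriving transformation: a natural $\mathsf d_A:!A\otimes A\to!A$ satisfying (up to the canonical associativity isomorphisms) $\mathsf e_A\circ\mathsf d_A=0$; $\Delta_A\circ\mathsf d_A=(\mathsf d_A\otimes1_{!A})\circ(1_{!A}\otimes\sigma_{!A,A})\circ(\Delta_A\otimes1_A)+(1_{!A}\otimes\mathsf d_A)\circ(\Delta_A\otimes1_A)$; $\varepsilon_A\circ\mathsf d_A=\ell_A\circ(\mathsf e_A\otimes1_A)$; $\delta_A\circ\mathsf d_A=\mathsf d_{!A}\circ(\delta_A\otimes\mathsf d_A)\circ(\Delta_A\otimes1_A)$ (the axioms of Blute–Cockett–Seely). Symmetric comonoidal monad $(\mathsf T,\mu,\eta,\mathsf n,\mathsf n_K)$: monad with natural $\mathsf n_{A,B}:\mathsf T(A\otimes B)\to\mathsf TA\otimes\mathsf TB$, $\mathsf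 n_K:\mathsf TK\to K$ making $\mathsf T$ symmetric comonoidal and $\mu,\eta$ comonoidal. $\mathbb X^{\mathsf T}$ (algebras, forgetful $U^{\mathsf T}$) is symmetric monoidal with $(A,\nu)\otimes^{\mathsf n}(B,\nu')=(A\otimes B,(\nu\otimes\nu')\circ\mathsf n_{A,B})$, unit $(K,\mathsf n_K)$; when $\mathsf T$ is additive, it is additive symmetric monoidal with sums computed in $\mathbb X$. A lifting of the coalgebra modality is a coalgebra modality $(\tilde!,\tilde\delta,\tilde\varepsilon,\tilde\Delta,\tilde{\mathsf e})$ on $\mathbb X^{\mathsf T}$ with $U^{\mathsf T}\tilde!=!\,U^{\mathsf T}$ and $U^{\mathsf T}$ sending $\tilde\delta,\tilde\varepsilon,\tilde\Delta,\tilde{\mathsf e}$ to $\delta,\varepsilon,\Delta,\mathsf e$. A coalgebra mixed distributive law is a natural $\lambda_A:\mathsf T!A\to!\mathsf TA$ with $\lambda_A\circ\mu_{!A}=!(\mu_A)\circ\lambda_{\mathsf TA}\circ\mathsf T(\lambda_A)$, $\lambda_A\circ\eta_{!A}=!(\eta_A)$, $\delta_{\mathsf TA}\circ\lambda_A=!(\lambda_A)\circ\lambda_{!A}\circ\mathsf T(\delta_A)$, $\varepsilon_{\mathsf TA}\circ\lambda_A=\mathsf T(\varepsilon_A)$, $\Delta_{\mathsf TA}\circ\lambda_A=(\lambda_A\otimes\lambda_A)\circ\mathsf n_{!A,!A}\circ\mathsf T(\Delta_A)$, $\mathsf e_{\mathsf TA}\circ\lambda_A=\mathsf n_K\circ\mathsf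 T(\mathsf e_A)$. A differential mixed distributive law is a coalgebra mixed distributive law with additionally $\lambda_A\circ\mathsf T(\mathsf d_A)=\mathsf d_{\mathsf TA}\circ(\lambda_A\otimes1_{\mathsf TA})\circ\mathsf n_{!A,A}$. -}

module Defs where

-- Conventions:
--  * categories are setoid-enriched: every hom-set carries an equivalence _≈_
--    (equality of morphisms) respected by composition; all equations below are ≈.
--  * composition is written g ∘ f (f first).

open import Level using (Level; _⊔_) renaming (suc to lsuc)
open import Relation.Binary using (Rel; IsEquivalence; Setoid)
open import Data.Product using (Σ; _,_; proj₁; proj₂; Σ-syntax)
import Relation.Binary.Reasoning.Setoid as SetoidR

record Category (o h e : Level) : Set (lsuc (o ⊔ h ⊔ e)) where
  infixr 9 _∘_
  infix 4 _≈_
  field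
    Obj : Set o
    Hom : Obj → Obj → Set h
    _≈_ : ∀ {A B} → Rel (Hom A B) e
    id  : ∀ {A} → Hom A A
    _∘_ : ∀ {A B C} → Hom B C → Hom A B → Hom A C
    equiv     : ∀ {A B} → IsEquivalence (_≈_ {A} {B})
    ∘-resp-≈  : ∀ {A B C} {f g : Hom B C} {h k : Hom A B} → f ≈ g → h ≈ k → f ∘ h ≈ g ∘ k
    assoc     : ∀ {A B C D} {f : Hom A B} {g : Hom B C} {h : Hom C D} → (h ∘ g) ∘ f ≈ h ∘ (g ∘ f)
    identityˡ : ∀ {A B} {f : Hom A B} → id ∘ f ≈ f
    identityʳ : ∀ {A B} {f : Hom A B} → f ∘ id ≈ f

  hom-setoid : Obj → Obj → Setoid h e
  hom-setoid A B = record { Carrier = Hom A B ; _≈_ = _≈_ ; isEquivalence = equiv }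

  module Eq {A B : Obj} = IsEquivalence (equiv {A} {B})

record Endofunctor {o h e} (C : Category o h e) : Set (o ⊔ h ⊔ e) where
  open Category C
  field
    F₀ : Obj → Obj
    F₁ : ∀ {A B} → Hom A B → Hom (F₀ A) (F₀ B)
    F-id : ∀ {A} → F₁ (id {A}) ≈ id
    F-∘  : ∀ {A B C} {f : Hom A B} {g : Hom B C} → F₁ (g ∘ f) ≈ F₁ g ∘ F₁ f
    F-resp-≈ : ∀ {A B} {f g : Hom A B} → f ≈ g → F₁ f ≈ F₁ g

record AdditiveSMC {o h e} (C : Category o h e) : Set (o ⊔ h ⊔ e) where
  open Category C
  infixr 10 _⊗₀_ _⊗₁_
  infixl 8 _+_
  field
    _⊗₀_ : Obj → Obj → Obj
    _⊗₁_ : ∀ {A B C D} → Hom A B → Hom C D → Hom (A ⊗₀ C) (B ⊗₀ D)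
    ⊗-id : ∀ {A B} → id {A} ⊗₁ id {B} ≈ id
    ⊗-∘  : ∀ {A B C D E F} {f : Hom B C} {g : Hom A B} {h : Hom E F} {k : Hom D E} →
           (f ∘ g) ⊗₁ (h ∘ k) ≈ (f ⊗₁ h) ∘ (g ⊗₁ k)
    ⊗-resp-≈ : ∀ {A B C D} {f g : Hom A B} {h k : Hom C D} → f ≈ g → h ≈ k → f ⊗₁ h ≈ g ⊗₁ k
    K  : Obj
    α⇒ : ∀ {A B C} → Hom ((A ⊗₀ B) ⊗₀ C) (A ⊗₀ (B ⊗₀ C))
    α⇐ : ∀ {A B C} → Hom (A ⊗₀ (B ⊗₀ C)) ((A ⊗₀ B) ⊗₀ C)
    ℓ⇒ : ∀ {A} → Hom (K ⊗₀ A) A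
    ℓ⇐ : ∀ {A} → Hom A (K ⊗₀ A)
    ρ⇒ : ∀ {A} → Hom (A ⊗₀ K) A
    ρ⇐ : ∀ {A} → Hom A (A ⊗₀ K)
    σ  : ∀ {A B} → Hom (A ⊗₀ B) (B ⊗₀ A)
    α-isoˡ : ∀ {A B C} → α⇐ ∘ α⇒ ≈ id {(A ⊗₀ B) ⊗₀ C}
    α-isoʳ : ∀ {A B C} → α⇒ ∘ α⇐ ≈ id {A ⊗₀ (B ⊗₀ C)}
    ℓ-isoˡ : ∀ {A} → ℓ⇐ ∘ ℓ⇒ ≈ id {K ⊗₀ A}
    ℓ-isoʳ : ∀ {A} → ℓ⇒ ∘ ℓ⇐ ≈ id {A}
    ρ-isoˡ : ∀ {A} → ρ⇐ ∘ ρ⇒ ≈ id {A ⊗₀ K}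
    ρ-isoʳ : ∀ {A} → ρ⇒ ∘ ρ⇐ ≈ id {A}
    α-nat : ∀ {A A' B B' C C'} {f : Hom A A'} {g : Hom B B'} {k : Hom C C'} →
            α⇒ ∘ ((f ⊗₁ g) ⊗₁ k) ≈ (f ⊗₁ (g ⊗₁ k)) ∘ α⇒
    ℓ-nat : ∀ {A B} {f : Hom A B} → ℓ⇒ ∘ (id {K} ⊗₁ f) ≈ f ∘ ℓ⇒
    ρ-nat : ∀ {A B} {f : Hom A B} → ρ⇒ ∘ (f ⊗₁ id {K}) ≈ f ∘ ρ⇒
    σ-nat : ∀ {A A' B B'} {f : Hom A A'} {g : Hom B B'} → σ ∘ (f ⊗₁ g) ≈ (g ⊗₁ f) ∘ σ
    pentagon : ∀ {A B C D} →
      (id {A} ⊗₁ α⇒ {B} {C} {D}) ∘ α⇒ ∘ (α⇒ ⊗₁ id) ≈ α⇒ ∘ α⇒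
    triangle : ∀ {A B} → (id {A} ⊗₁ ℓ⇒ {B}) ∘ α⇒ ≈ ρ⇒ ⊗₁ id
    hexagon : ∀ {A B C} →
      (id {B} ⊗₁ σ {A} {C}) ∘ α⇒ ∘ (σ ⊗₁ id) ≈ α⇒ ∘ σ ∘ α⇒
    σ-invol : ∀ {A B} → σ ∘ σ ≈ id {A ⊗₀ B}
    _+_ : ∀ {A B} → Hom A B → Hom A B → Hom A B
    0h  : ∀ {A B} → Hom A B
    +-resp-≈ : ∀ {A B} {f g h k : Hom A B} → f ≈ g → h ≈ k → f + h ≈ g + k
    +-assoc  : ∀ {A B} {f g h : Hom A B} → (f + g) + h ≈ f + (g + h)
    +-comm   : ∀ {A B} {f g : Hom A B} → f + g ≈ g + f
    +-identityˡ : ∀ {A B} {f : Hom A B} → 0h + f ≈ f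
    ∘-distribˡ : ∀ {A B C} {f : Hom B C} {g h : Hom A B} → f ∘ (g + h) ≈ f ∘ g + f ∘ h
    ∘-distribʳ : ∀ {A B C} {f : Hom A B} {g h : Hom B C} → (g + h) ∘ f ≈ g ∘ f + h ∘ f
    ∘-zeroˡ : ∀ {A B C} {f : Hom A B} → 0h {B} {C} ∘ f ≈ 0h
    ∘-zeroʳ : ∀ {A B C} {f : Hom B C} → f ∘ 0h {A} {B} ≈ 0h
    ⊗-distribˡ : ∀ {A B C D} {f : Hom A B} {g h : Hom C D} → f ⊗₁ (g + h) ≈ f ⊗₁ g + f ⊗₁ h
    ⊗-distribʳ : ∀ {A B C D} {f : Hom C D} {g h : Hom A B} → (g + h) ⊗₁ f ≈ g ⊗₁ f + h ⊗₁ f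
    ⊗-zeroˡ : ∀ {A B C D} {f : Hom C D} → 0h {A} {B} ⊗₁ f ≈ 0h
    ⊗-zeroʳ : ∀ {A B C D} {f : Hom A B} → f ⊗₁ 0h {C} {D} ≈ 0h

record CoalgebraModalityOn {o h e} {C : Category o h e} (𝔸 : AdditiveSMC C)
                           (B : Endofunctor C) : Set (o ⊔ h ⊔ e) where
  open Category C
  open AdditiveSMC 𝔸
  open Endofunctor B renaming (F₀ to !₀; F₁ to !₁)
  field
    δ : ∀ A → Hom (!₀ A) (!₀ (!₀ A))
    ε : ∀ A → Hom (!₀ A) A
    Δ : ∀ A → Hom (!₀ A) (!₀ A ⊗₀ !₀ A)
    𝕖 : ∀ A → Hom (!₀ A) K
    δ-nat : ∀ {A B} {f : Hom A B} → δ B ∘ !₁ f ≈ !₁ (!₁ f) ∘ δ A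
    ε-nat : ∀ {A B} {f : Hom A B} → ε B ∘ !₁ f ≈ f ∘ ε A
    Δ-nat : ∀ {A B} {f : Hom A B} → Δ B ∘ !₁ f ≈ (!₁ f ⊗₁ !₁ f) ∘ Δ A
    𝕖-nat : ∀ {A B} {f : Hom A B} → 𝕖 B ∘ !₁ f ≈ 𝕖 A
    comonad-idˡ : ∀ {A} → ε (!₀ A) ∘ δ A ≈ id
    comonad-idʳ : ∀ {A} → !₁ (ε A) ∘ δ A ≈ id
    comonad-assoc : ∀ {A} → !₁ (δ A) ∘ δ A ≈ δ (!₀ A) ∘ δ A
    Δ-coassoc : ∀ {A} → α⇒ ∘ (Δ A ⊗₁ id) ∘ Δ A ≈ (id ⊗₁ Δ A) ∘ Δ A
    Δ-counitˡ : ∀ {A} → ℓ⇒ ∘ (𝕖 A ⊗₁ id) ∘ Δ A ≈ id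
    Δ-counitʳ : ∀ {A} → ρ⇒ ∘ (id ⊗₁ 𝕖 A) ∘ Δ A ≈ id
    Δ-cocomm : ∀ {A} → σ ∘ Δ A ≈ Δ A
    δ-Δ : ∀ {A} → Δ (!₀ A) ∘ δ A ≈ (δ A ⊗₁ δ A) ∘ Δ A
    δ-𝕖 : ∀ {A} → 𝕖 (!₀ A) ∘ δ A ≈ 𝕖 A

record DerivingTransformation {o h e} {C : Category o h e} {𝔸 : AdditiveSMC C}
                              {B : Endofunctor C} (M : CoalgebraModalityOn 𝔸 B)
                              : Set (o ⊔ h ⊔ e) where
  open Category C
  open AdditiveSMC 𝔸
  open Endofunctor B renaming (F₀ to !₀; F₁ to !₁)
  open CoalgebraModalityOn M
  field
    d : ∀ A → Hom (!₀ A ⊗₀ A) (!₀ A)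
    d-nat : ∀ {A B} {f : Hom A B} → d B ∘ (!₁ f ⊗₁ f) ≈ !₁ f ∘ d A
    d-constant : ∀ {A} → 𝕖 A ∘ d A ≈ 0h
    d-product : ∀ {A} → Δ A ∘ d A ≈
        (d A ⊗₁ id) ∘ α⇐ ∘ (id ⊗₁ σ) ∘ α⇒ ∘ (Δ A ⊗₁ id)
      + (id ⊗₁ d A) ∘ α⇒ ∘ (Δ A ⊗₁ id)
    d-linear : ∀ {A} → ε A ∘ d A ≈ ℓ⇒ ∘ (𝕖 A ⊗₁ id)
    d-chain : ∀ {A} → δ A ∘ d A ≈ d (!₀ A) ∘ (δ A ⊗₁ d A) ∘ α⇒ ∘ (Δ A ⊗₁ id)

record DifferentialCategory (o h e : Level) : Set (lsuc (o ⊔ h ⊔ e)) where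
  field
    cat  : Category o h e
    asmc : AdditiveSMC cat
    bang : Endofunctor cat
    modality : CoalgebraModalityOn asmc bang
    deriving : DerivingTransformation modality

record AdditiveSymComonoidalMonad {o h e} {C : Category o h e} (𝔸 : AdditiveSMC C)
                                  : Set (o ⊔ h ⊔ e) where
  open Category C
  open AdditiveSMC 𝔸
  field
    functor : Endofunctor C
  open Endofunctor functor renaming (F₀ to T₀; F₁ to T₁)
  field
    μ : ∀ A → Hom (T₀ (T₀ A)) (T₀ A)
    η : ∀ A → Hom A (T₀ A)
    μ-nat : ∀ {A B} {f : Hom A B} → μ B ∘ T₁ (T₁ f) ≈ T₁ f ∘ μ A
    η-nat : ∀ {A B} {f : Hom A B} → η B ∘ f ≈ T₁ f ∘ η A
    monad-assoc : ∀ {A} → μ A ∘ T₁ (μ A) ≈ μ A ∘ μ (T₀ A)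
    monad-idˡ   : ∀ {A} → μ A ∘ T₁ (η A) ≈ id
    monad-idʳ   : ∀ {A} → μ A ∘ η (T₀ A) ≈ id
    n  : ∀ A B → Hom (T₀ (A ⊗₀ B)) (T₀ A ⊗₀ T₀ B)
    nK : Hom (T₀ K) K
    n-nat : ∀ {A A' B B'} {f : Hom A A'} {g : Hom B B'} →
            n A' B' ∘ T₁ (f ⊗₁ g) ≈ (T₁ f ⊗₁ T₁ g) ∘ n A B
    n-assoc : ∀ {A B C} →
      α⇒ ∘ (n A B ⊗₁ id) ∘ n (A ⊗₀ B) C ≈ (id ⊗₁ n B C) ∘ n A (B ⊗₀ C) ∘ T₁ α⇒
    n-unitˡ : ∀ {A} → ℓ⇒ ∘ (nK ⊗₁ id) ∘ n K A ≈ T₁ ℓ⇒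
    n-unitʳ : ∀ {A} → ρ⇒ ∘ (id ⊗₁ nK) ∘ n A K ≈ T₁ ρ⇒
    n-sym   : ∀ {A B} → σ ∘ n A B ≈ n B A ∘ T₁ σ
    μ-n  : ∀ {A B} → n A B ∘ μ (A ⊗₀ B) ≈ (μ A ⊗₁ μ B) ∘ n (T₀ A) (T₀ B) ∘ T₁ (n A B)
    μ-nK : nK ∘ μ K ≈ nK ∘ T₁ nK
    η-n  : ∀ {A B} → n A B ∘ η (A ⊗₀ B) ≈ η A ⊗₁ η B
    η-nK : nK ∘ η K ≈ id
    T-+ : ∀ {A B} {f g : Hom A B} → T₁ (f + g) ≈ T₁ f + T₁ g
    T-0 : ∀ {A B} → T₁ (0h {A} {B}) ≈ 0h

module HomReasoning {o h e} (C : Category o h e) where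
  open Category C
  module HR {A B : Obj} = SetoidR (hom-setoid A B)
  open HR public
  infixr 4 _⟩∘⟨_ refl⟩∘⟨_
  infixl 5 _⟩∘⟨refl
  _⟩∘⟨_ : ∀ {A B C} {f g : Hom B C} {h k : Hom A B} → f ≈ g → h ≈ k → f ∘ h ≈ g ∘ k
  _⟩∘⟨_ = ∘-resp-≈
  refl⟩∘⟨_ : ∀ {A B C} {f : Hom B C} {h k : Hom A B} → h ≈ k → f ∘ h ≈ f ∘ k
  refl⟩∘⟨ p = ∘-resp-≈ Eq.refl p
  _⟩∘⟨refl : ∀ {A B C} {f g : Hom B C} {h : Hom A B} → f ≈ g → f ∘ h ≈ g ∘ h
  p ⟩∘⟨refl = ∘-resp-≈ p Eq.refl
  sym-assoc : ∀ {A B C D} {f : Hom A B} {g : Hom B C} {h : Hom C D} → h ∘ (g ∘ f) ≈ (h ∘ g) ∘ f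
  sym-assoc = Eq.sym assoc

module EilenbergMoore {o h e} {C : Category o h e} {𝔸 : AdditiveSMC C}
                      (𝕋 : AdditiveSymComonoidalMonad 𝔸) where
  open Category C
  open AdditiveSMC 𝔸
  open AdditiveSymComonoidalMonad 𝕋
  open Endofunctor functor renaming (F₀ to T₀; F₁ to T₁)
  open HomReasoning C

  record Algebra : Set (o ⊔ h ⊔ e) where
    field
      A    : Obj
      ν    : Hom (T₀ A) A
      ν-η  : ν ∘ η A ≈ id
      ν-μ  : ν ∘ μ A ≈ ν ∘ T₁ ν
  open Algebra public

  IsAlgHom : (X Y : Algebra) → Hom (A X) (A Y) → Set e
  IsAlgHom X Y f = f ∘ ν X ≈ ν Y ∘ T₁ f

  AlgHom : Algebra → Algebra → Set (h ⊔ e)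
  AlgHom X Y = Σ (Hom (A X) (A Y)) (IsAlgHom X Y)

  alg-id : ∀ {X} → IsAlgHom X X id
  alg-id {X} = begin
    id ∘ ν X        ≈⟨ identityˡ ⟩
    ν X             ≈˘⟨ identityʳ ⟩
    ν X ∘ id        ≈˘⟨ refl⟩∘⟨ F-id ⟩
    ν X ∘ T₁ id     ∎

  alg-∘ : ∀ {X Y Z} {f g} → IsAlgHom Y Z g → IsAlgHom X Y f → IsAlgHom X Z (g ∘ f)
  alg-∘ {X} {Y} {Z} {f} {g} pg pf = begin
    (g ∘ f) ∘ ν X          ≈⟨ assoc ⟩
    g ∘ (f ∘ ν X)          ≈⟨ refl⟩∘⟨ pf ⟩
    g ∘ (ν Y ∘ T₁ f)       ≈⟨ sym-assoc ⟩
    (g ∘ ν Y) ∘ T₁ f       ≈⟨ pg ⟩∘⟨refl ⟩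
    (ν Z ∘ T₁ g) ∘ T₁ f    ≈⟨ assoc ⟩
    ν Z ∘ (T₁ g ∘ T₁ f)    ≈˘⟨ refl⟩∘⟨ F-∘ ⟩
    ν Z ∘ T₁ (g ∘ f)       ∎

  alg-inv : ∀ {X Y} {f g} → IsAlgHom X Y f → g ∘ f ≈ id → f ∘ g ≈ id → IsAlgHom Y X g
  alg-inv {X} {Y} {f} {g} pf gf fg = begin
    g ∘ ν Y                         ≈˘⟨ identityʳ ⟩
    (g ∘ ν Y) ∘ id                  ≈˘⟨ refl⟩∘⟨ F-id ⟩
    (g ∘ ν Y) ∘ T₁ id               ≈˘⟨ refl⟩∘⟨ F-resp-≈ fg ⟩
    (g ∘ ν Y) ∘ T₁ (f ∘ g)          ≈⟨ refl⟩∘⟨ F-∘ ⟩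
    (g ∘ ν Y) ∘ (T₁ f ∘ T₁ g)       ≈⟨ sym-assoc ⟩
    ((g ∘ ν Y) ∘ T₁ f) ∘ T₁ g       ≈⟨ assoc ⟩∘⟨refl ⟩
    (g ∘ (ν Y ∘ T₁ f)) ∘ T₁ g       ≈˘⟨ (refl⟩∘⟨ pf) ⟩∘⟨refl ⟩
    (g ∘ (f ∘ ν X)) ∘ T₁ g          ≈⟨ sym-assoc ⟩∘⟨refl ⟩
    ((g ∘ f) ∘ ν X) ∘ T₁ g          ≈⟨ (gf ⟩∘⟨refl) ⟩∘⟨refl ⟩
    (id ∘ ν X) ∘ T₁ g               ≈⟨ identityˡ ⟩∘⟨refl ⟩
    ν X ∘ T₁ g                      ∎

  alg-resp : ∀ {X Y} {f g} → f ≈ g → IsAlgHom X Y f → IsAlgHom X Y g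
  alg-resp {X} {Y} {f} {g} f≈g pf = begin
    g ∘ ν X      ≈˘⟨ f≈g ⟩∘⟨refl ⟩
    f ∘ ν X      ≈⟨ pf ⟩
    ν Y ∘ T₁ f   ≈⟨ refl⟩∘⟨ F-resp-≈ f≈g ⟩
    ν Y ∘ T₁ g   ∎

  alg-+ : ∀ {X Y} {f g} → IsAlgHom X Y f → IsAlgHom X Y g → IsAlgHom X Y (f + g)
  alg-+ {X} {Y} {f} {g} pf pg = begin
    (f + g) ∘ ν X                  ≈⟨ ∘-distribʳ ⟩
    f ∘ ν X + g ∘ ν X              ≈⟨ +-resp-≈ pf pg ⟩
    ν Y ∘ T₁ f + ν Y ∘ T₁ g        ≈˘⟨ ∘-distribˡ ⟩
    ν Y ∘ (T₁ f + T₁ g)            ≈˘⟨ refl⟩∘⟨ T-+ ⟩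
    ν Y ∘ T₁ (f + g)               ∎

  alg-0 : ∀ {X Y} → IsAlgHom X Y 0h
  alg-0 {X} {Y} = begin
    0h ∘ ν X        ≈⟨ ∘-zeroˡ ⟩
    0h              ≈˘⟨ ∘-zeroʳ ⟩
    ν Y ∘ 0h        ≈˘⟨ refl⟩∘⟨ T-0 ⟩
    ν Y ∘ T₁ 0h     ∎

  ⊗-split : ∀ {A B C D E F} {f : Hom B C} {g : Hom A B} {h : Hom E F} {k : Hom D E} →
            (f ∘ g) ⊗₁ (h ∘ k) ≈ (f ⊗₁ h) ∘ (g ⊗₁ k)
  ⊗-split = ⊗-∘

  _⊗ⁿ_ : Algebra → Algebra → Algebra
  X ⊗ⁿ Y = record
    { A   = A X ⊗₀ A Y
    ; ν   = (ν X ⊗₁ ν Y) ∘ n (A X) (A Y)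
    ; ν-η = begin
        ((ν X ⊗₁ ν Y) ∘ n (A X) (A Y)) ∘ η _   ≈⟨ assoc ⟩
        (ν X ⊗₁ ν Y) ∘ (n (A X) (A Y) ∘ η _)   ≈⟨ refl⟩∘⟨ η-n ⟩
        (ν X ⊗₁ ν Y) ∘ (η _ ⊗₁ η _)            ≈˘⟨ ⊗-∘ ⟩
        (ν X ∘ η _) ⊗₁ (ν Y ∘ η _)              ≈⟨ ⊗-resp-≈ (ν-η X) (ν-η Y) ⟩
        id ⊗₁ id                                ≈⟨ ⊗-id ⟩
        id                                      ∎
    ; ν-μ = begin
        ((ν X ⊗₁ ν Y) ∘ n (A X) (A Y)) ∘ μ _                                  ≈⟨ assoc ⟩
        (ν X ⊗₁ ν Y) ∘ (n (A X) (A Y) ∘ μ _)                                  ≈⟨ refl⟩∘⟨ μ-n ⟩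
        (ν X ⊗₁ ν Y) ∘ ((μ _ ⊗₁ μ _) ∘ n _ _ ∘ T₁ (n _ _))                   ≈⟨ sym-assoc ⟩
        ((ν X ⊗₁ ν Y) ∘ (μ _ ⊗₁ μ _)) ∘ (n _ _ ∘ T₁ (n _ _))                 ≈˘⟨ ⊗-∘ ⟩∘⟨refl ⟩
        ((ν X ∘ μ _) ⊗₁ (ν Y ∘ μ _)) ∘ (n _ _ ∘ T₁ (n _ _))                   ≈⟨ ⊗-resp-≈ (ν-μ X) (ν-μ Y) ⟩∘⟨refl ⟩
        ((ν X ∘ T₁ (ν X)) ⊗₁ (ν Y ∘ T₁ (ν Y))) ∘ (n _ _ ∘ T₁ (n _ _))       ≈⟨ ⊗-∘ ⟩∘⟨refl ⟩
        ((ν X ⊗₁ ν Y) ∘ (T₁ (ν X) ⊗₁ T₁ (ν Y))) ∘ (n _ _ ∘ T₁ (n _ _))     ≈⟨ assoc ⟩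
        (ν X ⊗₁ ν Y) ∘ ((T₁ (ν X) ⊗₁ T₁ (ν Y)) ∘ (n _ _ ∘ T₁ (n _ _)))     ≈⟨ refl⟩∘⟨ sym-assoc ⟩
        (ν X ⊗₁ ν Y) ∘ (((T₁ (ν X) ⊗₁ T₁ (ν Y)) ∘ n _ _) ∘ T₁ (n _ _))     ≈˘⟨ refl⟩∘⟨ n-nat ⟩∘⟨refl ⟩
        (ν X ⊗₁ ν Y) ∘ ((n _ _ ∘ T₁ (ν X ⊗₁ ν Y)) ∘ T₁ (n _ _))            ≈⟨ refl⟩∘⟨ assoc ⟩
        (ν X ⊗₁ ν Y) ∘ (n _ _ ∘ (T₁ (ν X ⊗₁ ν Y) ∘ T₁ (n _ _)))            ≈˘⟨ refl⟩∘⟨ refl⟩∘⟨ F-∘ ⟩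
        (ν X ⊗₁ ν Y) ∘ (n _ _ ∘ T₁ ((ν X ⊗₁ ν Y) ∘ n _ _))                 ≈⟨ sym-assoc ⟩
        ((ν X ⊗₁ ν Y) ∘ n _ _) ∘ T₁ ((ν X ⊗₁ ν Y) ∘ n _ _)                 ∎
    }

  Kⁿ : Algebra
  Kⁿ = record
    { A = K ; ν = nK ; ν-η = η-nK ; ν-μ = μ-nK }

  alg-⊗ : ∀ {X X' Y Y'} {f g} → IsAlgHom X X' f → IsAlgHom Y Y' g →
          IsAlgHom (X ⊗ⁿ Y) (X' ⊗ⁿ Y') (f ⊗₁ g)
  alg-⊗ {X} {X'} {Y} {Y'} {f} {g} pf pg = begin
    (f ⊗₁ g) ∘ ((ν X ⊗₁ ν Y) ∘ n _ _)              ≈⟨ sym-assoc ⟩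
    ((f ⊗₁ g) ∘ (ν X ⊗₁ ν Y)) ∘ n _ _              ≈˘⟨ ⊗-∘ ⟩∘⟨refl ⟩
    ((f ∘ ν X) ⊗₁ (g ∘ ν Y)) ∘ n _ _               ≈⟨ ⊗-resp-≈ pf pg ⟩∘⟨refl ⟩
    ((ν X' ∘ T₁ f) ⊗₁ (ν Y' ∘ T₁ g)) ∘ n _ _       ≈⟨ ⊗-∘ ⟩∘⟨refl ⟩
    ((ν X' ⊗₁ ν Y') ∘ (T₁ f ⊗₁ T₁ g)) ∘ n _ _      ≈⟨ assoc ⟩
    (ν X' ⊗₁ ν Y') ∘ ((T₁ f ⊗₁ T₁ g) ∘ n _ _)      ≈˘⟨ refl⟩∘⟨ n-nat ⟩
    (ν X' ⊗₁ ν Y') ∘ (n _ _ ∘ T₁ (f ⊗₁ g))         ≈⟨ sym-assoc ⟩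
    ((ν X' ⊗₁ ν Y') ∘ n _ _) ∘ T₁ (f ⊗₁ g)         ∎

  ⊗-∘ˡ : ∀ {A B C D E} {f : Hom B C} {g : Hom A B} {k : Hom D E} →
         (f ∘ g) ⊗₁ k ≈ (f ⊗₁ k) ∘ (g ⊗₁ id)
  ⊗-∘ˡ = Eq.trans (⊗-resp-≈ Eq.refl (Eq.sym identityʳ)) ⊗-∘
  ⊗-∘ʳ : ∀ {A B C D E} {f : Hom B C} {g : Hom A B} {k : Hom D E} →
         k ⊗₁ (f ∘ g) ≈ (k ⊗₁ f) ∘ (id ⊗₁ g)
  ⊗-∘ʳ = Eq.trans (⊗-resp-≈ (Eq.sym identityʳ) Eq.refl) ⊗-∘

  alg-α⇒ : ∀ {X Y Z} → IsAlgHom ((X ⊗ⁿ Y) ⊗ⁿ Z) (X ⊗ⁿ (Y ⊗ⁿ Z)) α⇒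
  alg-α⇒ {X} {Y} {Z} = begin
    α⇒ ∘ ((((ν X ⊗₁ ν Y) ∘ n _ _) ⊗₁ ν Z) ∘ n _ _)
      ≈⟨ refl⟩∘⟨ ⊗-∘ˡ ⟩∘⟨refl ⟩
    α⇒ ∘ ((((ν X ⊗₁ ν Y) ⊗₁ ν Z) ∘ (n _ _ ⊗₁ id)) ∘ n _ _)
      ≈⟨ refl⟩∘⟨ assoc ⟩
    α⇒ ∘ (((ν X ⊗₁ ν Y) ⊗₁ ν Z) ∘ ((n _ _ ⊗₁ id) ∘ n _ _))
      ≈⟨ sym-assoc ⟩
    (α⇒ ∘ ((ν X ⊗₁ ν Y) ⊗₁ ν Z)) ∘ ((n _ _ ⊗₁ id) ∘ n _ _)
      ≈⟨ α-nat ⟩∘⟨refl ⟩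
    ((ν X ⊗₁ (ν Y ⊗₁ ν Z)) ∘ α⇒) ∘ ((n _ _ ⊗₁ id) ∘ n _ _)
      ≈⟨ assoc ⟩
    (ν X ⊗₁ (ν Y ⊗₁ ν Z)) ∘ (α⇒ ∘ (n _ _ ⊗₁ id) ∘ n _ _)
      ≈⟨ refl⟩∘⟨ n-assoc ⟩
    (ν X ⊗₁ (ν Y ⊗₁ ν Z)) ∘ ((id ⊗₁ n _ _) ∘ n _ _ ∘ T₁ α⇒)
      ≈⟨ sym-assoc ⟩
    ((ν X ⊗₁ (ν Y ⊗₁ ν Z)) ∘ (id ⊗₁ n _ _)) ∘ (n _ _ ∘ T₁ α⇒)
      ≈˘⟨ ⊗-∘ʳ ⟩∘⟨refl ⟩
    (ν X ⊗₁ ((ν Y ⊗₁ ν Z) ∘ n _ _)) ∘ (n _ _ ∘ T₁ α⇒)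
      ≈⟨ sym-assoc ⟩
    ((ν X ⊗₁ ((ν Y ⊗₁ ν Z) ∘ n _ _)) ∘ n _ _) ∘ T₁ α⇒
      ∎

  alg-α⇐ : ∀ {X Y Z} → IsAlgHom (X ⊗ⁿ (Y ⊗ⁿ Z)) ((X ⊗ⁿ Y) ⊗ⁿ Z) α⇐
  alg-α⇐ {X} {Y} {Z} = alg-inv {(X ⊗ⁿ Y) ⊗ⁿ Z} {X ⊗ⁿ (Y ⊗ⁿ Z)} (alg-α⇒ {X} {Y} {Z}) α-isoˡ α-isoʳ

  alg-ℓ⇒ : ∀ {X} → IsAlgHom (Kⁿ ⊗ⁿ X) X ℓ⇒
  alg-ℓ⇒ {X} = begin
    ℓ⇒ ∘ ((nK ⊗₁ ν X) ∘ n _ _)                   ≈⟨ refl⟩∘⟨ (⊗-resp-≈ (Eq.sym identityˡ) (Eq.sym identityʳ) ⟩∘⟨refl) ⟩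
    ℓ⇒ ∘ (((id ∘ nK) ⊗₁ (ν X ∘ id)) ∘ n _ _)     ≈⟨ refl⟩∘⟨ (⊗-∘ ⟩∘⟨refl) ⟩
    ℓ⇒ ∘ (((id ⊗₁ ν X) ∘ (nK ⊗₁ id)) ∘ n _ _)    ≈⟨ refl⟩∘⟨ assoc ⟩
    ℓ⇒ ∘ ((id ⊗₁ ν X) ∘ ((nK ⊗₁ id) ∘ n _ _))    ≈⟨ sym-assoc ⟩
    (ℓ⇒ ∘ (id ⊗₁ ν X)) ∘ ((nK ⊗₁ id) ∘ n _ _)    ≈⟨ ℓ-nat ⟩∘⟨refl ⟩
    (ν X ∘ ℓ⇒) ∘ ((nK ⊗₁ id) ∘ n _ _)            ≈⟨ assoc ⟩
    ν X ∘ (ℓ⇒ ∘ (nK ⊗₁ id) ∘ n _ _)              ≈⟨ refl⟩∘⟨ n-unitˡ ⟩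
    ν X ∘ T₁ ℓ⇒                                  ∎

  alg-ℓ⇐ : ∀ {X} → IsAlgHom X (Kⁿ ⊗ⁿ X) ℓ⇐
  alg-ℓ⇐ {X} = alg-inv {Kⁿ ⊗ⁿ X} {X} (alg-ℓ⇒ {X}) ℓ-isoˡ ℓ-isoʳ

  alg-ρ⇒ : ∀ {X} → IsAlgHom (X ⊗ⁿ Kⁿ) X ρ⇒
  alg-ρ⇒ {X} = begin
    ρ⇒ ∘ ((ν X ⊗₁ nK) ∘ n _ _)                   ≈⟨ refl⟩∘⟨ (⊗-resp-≈ (Eq.sym identityʳ) (Eq.sym identityˡ) ⟩∘⟨refl) ⟩
    ρ⇒ ∘ (((ν X ∘ id) ⊗₁ (id ∘ nK)) ∘ n _ _)     ≈⟨ refl⟩∘⟨ (⊗-∘ ⟩∘⟨refl) ⟩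
    ρ⇒ ∘ (((ν X ⊗₁ id) ∘ (id ⊗₁ nK)) ∘ n _ _)    ≈⟨ refl⟩∘⟨ assoc ⟩
    ρ⇒ ∘ ((ν X ⊗₁ id) ∘ ((id ⊗₁ nK) ∘ n _ _))    ≈⟨ sym-assoc ⟩
    (ρ⇒ ∘ (ν X ⊗₁ id)) ∘ ((id ⊗₁ nK) ∘ n _ _)    ≈⟨ ρ-nat ⟩∘⟨refl ⟩
    (ν X ∘ ρ⇒) ∘ ((id ⊗₁ nK) ∘ n _ _)            ≈⟨ assoc ⟩
    ν X ∘ (ρ⇒ ∘ (id ⊗₁ nK) ∘ n _ _)              ≈⟨ refl⟩∘⟨ n-unitʳ ⟩
    ν X ∘ T₁ ρ⇒                                  ∎

  alg-ρ⇐ : ∀ {X} → IsAlgHom X (X ⊗ⁿ Kⁿ) ρ⇐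
  alg-ρ⇐ {X} = alg-inv {X ⊗ⁿ Kⁿ} {X} (alg-ρ⇒ {X}) ρ-isoˡ ρ-isoʳ

  alg-σ : ∀ {X Y} → IsAlgHom (X ⊗ⁿ Y) (Y ⊗ⁿ X) σ
  alg-σ {X} {Y} = begin
    σ ∘ ((ν X ⊗₁ ν Y) ∘ n _ _)     ≈⟨ sym-assoc ⟩
    (σ ∘ (ν X ⊗₁ ν Y)) ∘ n _ _     ≈⟨ σ-nat ⟩∘⟨refl ⟩
    ((ν Y ⊗₁ ν X) ∘ σ) ∘ n _ _     ≈⟨ assoc ⟩
    (ν Y ⊗₁ ν X) ∘ (σ ∘ n _ _)     ≈⟨ refl⟩∘⟨ n-sym ⟩
    (ν Y ⊗₁ ν X) ∘ (n _ _ ∘ T₁ σ)  ≈⟨ sym-assoc ⟩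
    ((ν Y ⊗₁ ν X) ∘ n _ _) ∘ T₁ σ  ∎

  EM : Category (o ⊔ h ⊔ e) (h ⊔ e) e
  EM = record
    { Obj = Algebra
    ; Hom = AlgHom
    ; _≈_ = λ f g → proj₁ f ≈ proj₁ g
    ; id  = λ {X} → id , alg-id {X}
    ; _∘_ = λ {X} {Y} {Z} g f → (proj₁ g ∘ proj₁ f) , alg-∘ {X} {Y} {Z} (proj₂ g) (proj₂ f)
    ; equiv = record { refl = Eq.refl ; sym = Eq.sym ; trans = Eq.trans }
    ; ∘-resp-≈ = ∘-resp-≈
    ; assoc = assoc
    ; identityˡ = identityˡ
    ; identityʳ = identityʳ
    }

  U₁ : ∀ {X Y} → AlgHom X Y → Hom (A X) (A Y)
  U₁ = proj₁

  EM-ASMC : AdditiveSMC EM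
  EM-ASMC = record
    { _⊗₀_ = _⊗ⁿ_
    ; _⊗₁_ = λ {X} {X'} {Y} {Y'} f g → (proj₁ f ⊗₁ proj₁ g) , alg-⊗ {X} {X'} {Y} {Y'} (proj₂ f) (proj₂ g)
    ; ⊗-id = ⊗-id
    ; ⊗-∘ = ⊗-∘
    ; ⊗-resp-≈ = ⊗-resp-≈
    ; K = Kⁿ
    ; α⇒ = λ {X} {Y} {Z} → α⇒ , alg-α⇒ {X} {Y} {Z}
    ; α⇐ = λ {X} {Y} {Z} → α⇐ , alg-α⇐ {X} {Y} {Z}
    ; ℓ⇒ = λ {X} → ℓ⇒ , alg-ℓ⇒ {X}
    ; ℓ⇐ = λ {X} → ℓ⇐ , alg-ℓ⇐ {X}
    ; ρ⇒ = λ {X} → ρ⇒ , alg-ρ⇒ {X}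
    ; ρ⇐ = λ {X} → ρ⇐ , alg-ρ⇐ {X}
    ; σ = λ {X} {Y} → σ , alg-σ {X} {Y}
    ; α-isoˡ = α-isoˡ
    ; α-isoʳ = α-isoʳ
    ; ℓ-isoˡ = ℓ-isoˡ
    ; ℓ-isoʳ = ℓ-isoʳ
    ; ρ-isoˡ = ρ-isoˡ
    ; ρ-isoʳ = ρ-isoʳ
    ; α-nat = α-nat
    ; ℓ-nat = ℓ-nat
    ; ρ-nat = ρ-nat
    ; σ-nat = σ-nat
    ; pentagon = pentagon
    ; triangle = triangle
    ; hexagon = hexagon
    ; σ-invol = σ-invol
    ; _+_ = λ {X} {Y} f g → (proj₁ f + proj₁ g) , alg-+ {X} {Y} (proj₂ f) (proj₂ g)
    ; 0h = λ {X} {Y} → 0h , alg-0 {X} {Y}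
    ; +-resp-≈ = +-resp-≈
    ; +-assoc = +-assoc
    ; +-comm = +-comm
    ; +-identityˡ = +-identityˡ
    ; ∘-distribˡ = ∘-distribˡ
    ; ∘-distribʳ = ∘-distribʳ
    ; ∘-zeroˡ = ∘-zeroˡ
    ; ∘-zeroʳ = ∘-zeroʳ
    ; ⊗-distribˡ = ⊗-distribˡ
    ; ⊗-distribʳ = ⊗-distribʳ
    ; ⊗-zeroˡ = ⊗-zeroˡ
    ; ⊗-zeroʳ = ⊗-zeroʳ
    }

module Liftings {o h e} (𝔻 : DifferentialCategory o h e)
                (𝕋 : AdditiveSymComonoidalMonad (DifferentialCategory.asmc 𝔻)) where
  open DifferentialCategory 𝔻
  open Category cat
  open AdditiveSMC asmc
  open Endofunctor bang renaming (F₀ to !₀; F₁ to !₁; F-id to !-id; F-∘ to !-∘; F-resp-≈ to !-resp-≈)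
  open CoalgebraModalityOn modality
  open DerivingTransformation deriving
  open AdditiveSymComonoidalMonad 𝕋
  open Endofunctor functor renaming (F₀ to T₀; F₁ to T₁)
  open EilenbergMoore 𝕋

  record DifferentialMixedDistributiveLaw : Set (o ⊔ h ⊔ e) where
    field
      λ′ : ∀ A → Hom (T₀ (!₀ A)) (!₀ (T₀ A))
      λ-nat : ∀ {A B} {f : Hom A B} → !₁ (T₁ f) ∘ λ′ A ≈ λ′ B ∘ T₁ (!₁ f)
      λ-μ : ∀ {A} → λ′ A ∘ μ (!₀ A) ≈ !₁ (μ A) ∘ λ′ (T₀ A) ∘ T₁ (λ′ A)
      λ-η : ∀ {A} → λ′ A ∘ η (!₀ A) ≈ !₁ (η A)
      λ-δ : ∀ {A} → δ (T₀ A) ∘ λ′ A ≈ !₁ (λ′ A) ∘ λ′ (!₀ A) ∘ T₁ (δ A)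
      λ-ε : ∀ {A} → ε (T₀ A) ∘ λ′ A ≈ T₁ (ε A)
      λ-Δ : ∀ {A} → Δ (T₀ A) ∘ λ′ A ≈ (λ′ A ⊗₁ λ′ A) ∘ n (!₀ A) (!₀ A) ∘ T₁ (Δ A)
      λ-𝕖 : ∀ {A} → 𝕖 (T₀ A) ∘ λ′ A ≈ nK ∘ T₁ (𝕖 A)
      λ-d : ∀ {A} → λ′ A ∘ T₁ (d A) ≈ d (T₀ A) ∘ (λ′ A ⊗₁ id) ∘ n (!₀ A) A

  -- A lifting of the functor ! along U^T: on objects (A , ν) ↦ (!A , ω (A , ν)),
  -- on morphisms f ↦ ! f  (so that U^T ∘ !̃ = ! ∘ U^T strictly).
  record BangLift : Set (o ⊔ h ⊔ e) where
    field
      ω   : ∀ X → Hom (T₀ (!₀ (A X))) (!₀ (A X))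
      ω-η : ∀ {X} → ω X ∘ η (!₀ (A X)) ≈ id
      ω-μ : ∀ {X} → ω X ∘ μ (!₀ (A X)) ≈ ω X ∘ T₁ (ω X)
      ω-! : ∀ {X Y} (f : AlgHom X Y) → !₁ (proj₁ f) ∘ ω X ≈ ω Y ∘ T₁ (!₁ (proj₁ f))

  module _ (B : BangLift) where
    open BangLift B
    !̃₀ : Algebra → Algebra
    !̃₀ X = record { A = !₀ (A X) ; ν = ω X ; ν-η = ω-η ; ν-μ = ω-μ }

    !̃ : Endofunctor EM
    !̃ = record
      { F₀ = !̃₀
      ; F₁ = λ f → !₁ (proj₁ f) , ω-! f
      ; F-id = !-id
      ; F-∘ = !-∘
      ; F-resp-≈ = !-resp-≈
      }

  record CoalgebraModalityLifting : Set (o ⊔ h ⊔ e) where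
    field
      bangLift : BangLift
      modalityᵀ : CoalgebraModalityOn EM-ASMC (!̃ bangLift)
    module M̃ = CoalgebraModalityOn modalityᵀ
    field
      δ-lift : ∀ X → proj₁ (M̃.δ X) ≈ δ (A X)
      ε-lift : ∀ X → proj₁ (M̃.ε X) ≈ ε (A X)
      Δ-lift : ∀ X → proj₁ (M̃.Δ X) ≈ Δ (A X)
      𝕖-lift : ∀ X → proj₁ (M̃.𝕖 X) ≈ 𝕖 (A X)

  record DifferentialLifting : Set (o ⊔ h ⊔ e) where
    field
      coalgLift : CoalgebraModalityLifting
    open CoalgebraModalityLifting coalgLift
    field
      derivingᵀ : DerivingTransformation modalityᵀ
    module D̃ = DerivingTransformation derivingᵀ
    field
      d-lift : ∀ X → proj₁ (D̃.d X) ≈ d (A X)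

  liftedDifferentialCategory : DifferentialLifting → DifferentialCategory (o ⊔ h ⊔ e) (h ⊔ e) e
  liftedDifferentialCategory L = record
    { cat = EM ; asmc = EM-ASMC
    ; bang = !̃ (CoalgebraModalityLifting.bangLift (DifferentialLifting.coalgLift L))
    ; modality = CoalgebraModalityLifting.modalityᵀ (DifferentialLifting.coalgLift L)
    ; deriving = DifferentialLifting.derivingᵀ L
    }

  -- Equality of liftings: equality of the lifted
  -- algebra structures ω (all other data are determined, up to ≈, by lying over
  -- δ, ε, Δ, 𝕖, d and over ! on morphisms).
  DML-Setoid : Setoid (o ⊔ h ⊔ e) (o ⊔ e)
  DML-Setoid = record
    { Carrier = DifferentialMixedDistributiveLaw
    ; _≈_ = λ l l' → ∀ A → DifferentialMixedDistributiveLaw.λ′ l A ≈ DifferentialMixedDistributiveLaw.λ′ l' A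
    ; isEquivalence = record
      { refl = λ _ → Eq.refl ; sym = λ p A → Eq.sym (p A) ; trans = λ p q A → Eq.trans (p A) (q A) }
    }

  liftω : DifferentialLifting → ∀ X → Hom (T₀ (!₀ (A X))) (!₀ (A X))
  liftω L = BangLift.ω (CoalgebraModalityLifting.bangLift (DifferentialLifting.coalgLift L))

  DifferentialLifting-Setoid : Setoid (o ⊔ h ⊔ e) (o ⊔ h ⊔ e)
  DifferentialLifting-Setoid = record
    { Carrier = DifferentialLifting
    ; _≈_ = λ L L' → ∀ X → liftω L X ≈ liftω L' X
    ; isEquivalence = record
      { refl = λ _ → Eq.refl ; sym = λ p X → Eq.sym (p X) ; trans = λ p q X → Eq.trans (p X) (q X) }
    }

module Submission where

-- A lifting of ! along U^T is the same as a T-algebra structure ω on each !A, natural in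
-- algebra morphisms; such ω correspond to mixed distributive laws λ : T! ⇒ !T through
--   ω_(A,ν) = !ν ∘ λ_A      and      λ_A = ω_(TA,μ) ∘ T(!η_A).
-- Under this correspondence the compatibility axioms of λ with δ, ε, Δ, e and d say exactly
-- that these maps are T-algebra morphisms for the lifted structures.  Since equality of
-- algebra morphisms is equality of underlying maps, the remaining axioms of a coalgebra
-- modality and of a deriving transformation transfer from 𝕏 to 𝕏^T verbatim.

open import Defs
open import Function.Bundles using (Inverse)
open import Data.Product using (_,_; proj₁; proj₂)
open import Relation.Binary using (Setoid)
open import Function.Definitions using (Congruent; StrictlyInverseˡ; StrictlyInverseʳ; Inverseˡ; Inverseʳ)

module CategoryReasoning {o h e} (C : Category o h e) where
  open Category C
  open HomReasoning C

  pullˡ : ∀ {W X Y Z} {a : Hom Y Z} {b : Hom X Y} {c : Hom X Z} {x : Hom W X} →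
          a ∘ b ≈ c → a ∘ (b ∘ x) ≈ c ∘ x
  pullˡ p = Eq.trans sym-assoc (p ⟩∘⟨refl)

  pullʳ : ∀ {W X Y Z} {a : Hom Y Z} {b : Hom X Y} {c : Hom W Y} {x : Hom W X} →
          b ∘ x ≈ c → (a ∘ b) ∘ x ≈ a ∘ c
  pullʳ p = Eq.trans assoc (refl⟩∘⟨ p)

module FunctorReasoning {o h e} {C : Category o h e} (F : Endofunctor C) where
  open Category C
  open Endofunctor F

  F-resp-∘ : ∀ {X Y Z} {a : Hom Y Z} {b : Hom X Y} {c : Hom X Z} →
             a ∘ b ≈ c → F₁ a ∘ F₁ b ≈ F₁ c
  F-resp-∘ p = Eq.trans (Eq.sym F-∘) (F-resp-≈ p)

  F-resp-inverse : ∀ {X Y} {a : Hom Y X} {b : Hom X Y} → a ∘ b ≈ id → F₁ a ∘ F₁ b ≈ id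
  F-resp-inverse p = Eq.trans (F-resp-∘ p) F-id

module FreeAlgebras {o h e} {C : Category o h e} {𝔸 : AdditiveSMC C}
                    (𝕋 : AdditiveSymComonoidalMonad 𝔸) where
  open Category C
  open AdditiveSymComonoidalMonad 𝕋
  open Endofunctor functor renaming (F₀ to T₀; F₁ to T₁)
  open EilenbergMoore 𝕋

  free : Obj → Algebra
  free Z = record { A = T₀ Z ; ν = μ Z ; ν-η = monad-idʳ ; ν-μ = Eq.sym monad-assoc }

  free-map : ∀ {Z W} → Hom Z W → AlgHom (free Z) (free W)
  free-map f = T₁ f , Eq.sym μ-nat

  μ-algHom : ∀ Z → AlgHom (free (T₀ Z)) (free Z)
  μ-algHom Z = μ Z , Eq.sym monad-assoc

  ν-algHom : ∀ X → AlgHom (free (A X)) X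
  ν-algHom X = ν X , ν-μ X

module Correspondence {o h e} (𝔻 : DifferentialCategory o h e)
                      (𝕋 : AdditiveSymComonoidalMonad (DifferentialCategory.asmc 𝔻)) where
  open DifferentialCategory 𝔻
  open Category cat
  open AdditiveSMC asmc
  open Endofunctor bang renaming (F₀ to !₀; F₁ to !₁)
  open CoalgebraModalityOn modality
  open DerivingTransformation deriving
  open AdditiveSymComonoidalMonad 𝕋
  open Endofunctor functor renaming (F₀ to T₀; F₁ to T₁; F-∘ to T-∘; F-resp-≈ to T-resp-≈)
  open EilenbergMoore 𝕋
  open FreeAlgebras 𝕋
  open Liftings 𝔻 𝕋
  open HomReasoning cat
  open CategoryReasoning cat
  open FunctorReasoning bang renaming (F-resp-∘ to !-resp-∘; F-resp-inverse to !-resp-inverse)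
  open FunctorReasoning functor renaming (F-resp-∘ to T-resp-∘; F-resp-inverse to T-resp-inverse)

  module LawToLifting (l : DifferentialMixedDistributiveLaw) where
    open DifferentialMixedDistributiveLaw l

    ω : ∀ X → Hom (T₀ (!₀ (A X))) (!₀ (A X))
    ω X = !₁ (ν X) ∘ λ′ (A X)

    ω-η : ∀ {X} → ω X ∘ η (!₀ (A X)) ≈ id
    ω-η {X} = begin
      (!₁ (ν X) ∘ λ′ _) ∘ η _   ≈⟨ pullʳ λ-η ⟩
      !₁ (ν X) ∘ !₁ (η _)       ≈⟨ !-resp-inverse (ν-η X) ⟩
      id                        ∎

    ω-μ : ∀ {X} → ω X ∘ μ (!₀ (A X)) ≈ ω X ∘ T₁ (ω X)
    ω-μ {X} = begin
      (!₁ (ν X) ∘ λ′ _) ∘ μ _                             ≈⟨ pullʳ λ-μ ⟩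
      !₁ (ν X) ∘ (!₁ (μ _) ∘ λ′ _ ∘ T₁ (λ′ _))             ≈⟨ pullˡ (!-resp-∘ Eq.refl) ⟩
      !₁ (ν X ∘ μ _) ∘ (λ′ _ ∘ T₁ (λ′ _))                 ≈˘⟨ !-resp-∘ (Eq.sym (ν-μ X)) ⟩∘⟨refl ⟩
      (!₁ (ν X) ∘ !₁ (T₁ (ν X))) ∘ (λ′ _ ∘ T₁ (λ′ _))      ≈⟨ pullʳ (pullˡ λ-nat) ⟩
      !₁ (ν X) ∘ ((λ′ _ ∘ T₁ (!₁ (ν X))) ∘ T₁ (λ′ _))      ≈⟨ refl⟩∘⟨ pullʳ (T-resp-∘ Eq.refl) ⟩
      !₁ (ν X) ∘ (λ′ _ ∘ T₁ (ω X))                        ≈⟨ sym-assoc ⟩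
      ω X ∘ T₁ (ω X)                                      ∎

    ω-natural : ∀ {X Y} (f : AlgHom X Y) → !₁ (proj₁ f) ∘ ω X ≈ ω Y ∘ T₁ (!₁ (proj₁ f))
    ω-natural {X} {Y} (f , f-alg) = begin
      !₁ f ∘ (!₁ (ν X) ∘ λ′ _)        ≈⟨ pullˡ (!-resp-∘ Eq.refl) ⟩
      !₁ (f ∘ ν X) ∘ λ′ _             ≈˘⟨ !-resp-∘ (Eq.sym f-alg) ⟩∘⟨refl ⟩
      (!₁ (ν Y) ∘ !₁ (T₁ f)) ∘ λ′ _   ≈⟨ pullʳ λ-nat ⟩
      !₁ (ν Y) ∘ (λ′ _ ∘ T₁ (!₁ f))   ≈⟨ sym-assoc ⟩
      ω Y ∘ T₁ (!₁ f)                 ∎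

    bangLift : BangLift
    bangLift = record
      { ω = ω ; ω-η = λ {X} → ω-η {X} ; ω-μ = λ {X} → ω-μ {X} ; ω-! = λ {X} {Y} → ω-natural {X} {Y} }

    !ᵀ : Algebra → Algebra
    !ᵀ = !̃₀ bangLift

    δ-isAlgHom : ∀ X → IsAlgHom (!ᵀ X) (!ᵀ (!ᵀ X)) (δ (A X))
    δ-isAlgHom X = begin
      δ _ ∘ (!₁ (ν X) ∘ λ′ _)                        ≈⟨ pullˡ δ-nat ⟩
      (!₁ (!₁ (ν X)) ∘ δ _) ∘ λ′ _                   ≈⟨ pullʳ λ-δ ⟩
      !₁ (!₁ (ν X)) ∘ (!₁ (λ′ _) ∘ λ′ _ ∘ T₁ (δ _))  ≈⟨ pullˡ (!-resp-∘ Eq.refl) ⟩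
      !₁ (ω X) ∘ (λ′ _ ∘ T₁ (δ _))                   ≈⟨ sym-assoc ⟩
      (!₁ (ω X) ∘ λ′ _) ∘ T₁ (δ _)                   ∎

    ε-isAlgHom : ∀ X → IsAlgHom (!ᵀ X) X (ε (A X))
    ε-isAlgHom X = begin
      ε _ ∘ (!₁ (ν X) ∘ λ′ _)   ≈⟨ pullˡ ε-nat ⟩
      (ν X ∘ ε _) ∘ λ′ _        ≈⟨ pullʳ λ-ε ⟩
      ν X ∘ T₁ (ε _)            ∎

    Δ-isAlgHom : ∀ X → IsAlgHom (!ᵀ X) (!ᵀ X ⊗ⁿ !ᵀ X) (Δ (A X))
    Δ-isAlgHom X = begin
      Δ _ ∘ (!₁ (ν X) ∘ λ′ _)                                       ≈⟨ pullˡ Δ-nat ⟩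
      ((!₁ (ν X) ⊗₁ !₁ (ν X)) ∘ Δ _) ∘ λ′ _                         ≈⟨ pullʳ λ-Δ ⟩
      (!₁ (ν X) ⊗₁ !₁ (ν X)) ∘ ((λ′ _ ⊗₁ λ′ _) ∘ n _ _ ∘ T₁ (Δ _))  ≈⟨ pullˡ (Eq.sym ⊗-∘) ⟩
      (ω X ⊗₁ ω X) ∘ (n _ _ ∘ T₁ (Δ _))                             ≈⟨ sym-assoc ⟩
      ((ω X ⊗₁ ω X) ∘ n _ _) ∘ T₁ (Δ _)                             ∎

    𝕖-isAlgHom : ∀ X → IsAlgHom (!ᵀ X) Kⁿ (𝕖 (A X))
    𝕖-isAlgHom X = begin
      𝕖 _ ∘ (!₁ (ν X) ∘ λ′ _)   ≈⟨ pullˡ 𝕖-nat ⟩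
      𝕖 _ ∘ λ′ _                ≈⟨ λ-𝕖 ⟩
      nK ∘ T₁ (𝕖 _)             ∎

    d-isAlgHom : ∀ X → IsAlgHom (!ᵀ X ⊗ⁿ X) (!ᵀ X) (d (A X))
    d-isAlgHom X = Eq.sym (begin
      (!₁ (ν X) ∘ λ′ _) ∘ T₁ (d _)                         ≈⟨ pullʳ λ-d ⟩
      !₁ (ν X) ∘ (d _ ∘ (λ′ _ ⊗₁ id) ∘ n _ _)              ≈⟨ pullˡ (Eq.sym d-nat) ⟩
      (d _ ∘ (!₁ (ν X) ⊗₁ ν X)) ∘ ((λ′ _ ⊗₁ id) ∘ n _ _)   ≈⟨ pullʳ (pullˡ (Eq.sym ⊗-∘)) ⟩
      d _ ∘ ((ω X ⊗₁ (ν X ∘ id)) ∘ n _ _)                  ≈⟨ refl⟩∘⟨ ⊗-resp-≈ Eq.refl identityʳ ⟩∘⟨refl ⟩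
      d _ ∘ ((ω X ⊗₁ ν X) ∘ n _ _)                         ∎)

    coalgebraModalityLifting : CoalgebraModalityLifting
    coalgebraModalityLifting = record
      { bangLift = bangLift
      ; modalityᵀ = record
        { δ = λ X → δ (A X) , δ-isAlgHom X
        ; ε = λ X → ε (A X) , ε-isAlgHom X
        ; Δ = λ X → Δ (A X) , Δ-isAlgHom X
        ; 𝕖 = λ X → 𝕖 (A X) , 𝕖-isAlgHom X
        ; δ-nat = δ-nat ; ε-nat = ε-nat ; Δ-nat = Δ-nat ; 𝕖-nat = 𝕖-nat
        ; comonad-idˡ = comonad-idˡ ; comonad-idʳ = comonad-idʳ ; comonad-assoc = comonad-assoc
        ; Δ-coassoc = Δ-coassoc ; Δ-counitˡ = Δ-counitˡ ; Δ-counitʳ = Δ-counitʳ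
        ; Δ-cocomm = Δ-cocomm ; δ-Δ = δ-Δ ; δ-𝕖 = δ-𝕖
        }
      ; δ-lift = λ _ → Eq.refl
      ; ε-lift = λ _ → Eq.refl
      ; Δ-lift = λ _ → Eq.refl
      ; 𝕖-lift = λ _ → Eq.refl
      }

    differentialLifting : DifferentialLifting
    differentialLifting = record
      { coalgLift = coalgebraModalityLifting
      ; derivingᵀ = record
        { d = λ X → d (A X) , d-isAlgHom X
        ; d-nat = d-nat ; d-constant = d-constant ; d-product = d-product
        ; d-linear = d-linear ; d-chain = d-chain
        }
      ; d-lift = λ _ → Eq.refl
      }

  lawToLifting : DifferentialMixedDistributiveLaw → DifferentialLifting
  lawToLifting = LawToLifting.differentialLifting

  module LiftingToLaw (L : DifferentialLifting) where
    open DifferentialLifting L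
    open CoalgebraModalityLifting coalgLift
    open BangLift bangLift

    !ᵀ : Algebra → Algebra
    !ᵀ = !̃₀ bangLift

    δ-isAlgHom : ∀ X → IsAlgHom (!ᵀ X) (!ᵀ (!ᵀ X)) (δ (A X))
    δ-isAlgHom X = alg-resp { !ᵀ X} { !ᵀ (!ᵀ X)} (δ-lift X) (proj₂ (M̃.δ X))

    ε-isAlgHom : ∀ X → IsAlgHom (!ᵀ X) X (ε (A X))
    ε-isAlgHom X = alg-resp { !ᵀ X} {X} (ε-lift X) (proj₂ (M̃.ε X))

    Δ-isAlgHom : ∀ X → IsAlgHom (!ᵀ X) (!ᵀ X ⊗ⁿ !ᵀ X) (Δ (A X))
    Δ-isAlgHom X = alg-resp { !ᵀ X} { !ᵀ X ⊗ⁿ !ᵀ X} (Δ-lift X) (proj₂ (M̃.Δ X))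

    𝕖-isAlgHom : ∀ X → IsAlgHom (!ᵀ X) Kⁿ (𝕖 (A X))
    𝕖-isAlgHom X = alg-resp { !ᵀ X} {Kⁿ} (𝕖-lift X) (proj₂ (M̃.𝕖 X))

    d-isAlgHom : ∀ X → IsAlgHom (!ᵀ X ⊗ⁿ X) (!ᵀ X) (d (A X))
    d-isAlgHom X = alg-resp { !ᵀ X ⊗ⁿ X} { !ᵀ X} (d-lift X) (proj₂ (D̃.d X))

    λ′ : ∀ Z → Hom (T₀ (!₀ Z)) (!₀ (T₀ Z))
    λ′ Z = ω (free Z) ∘ T₁ (!₁ (η Z))

    λ′-isAlgHom : ∀ Z → IsAlgHom (free (!₀ Z)) (!ᵀ (free Z)) (λ′ Z)
    λ′-isAlgHom Z = begin
      (ω (free Z) ∘ T₁ (!₁ (η Z))) ∘ μ _                   ≈⟨ pullʳ (Eq.sym μ-nat) ⟩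
      ω (free Z) ∘ (μ _ ∘ T₁ (T₁ (!₁ (η Z))))              ≈⟨ pullˡ ω-μ ⟩
      (ω (free Z) ∘ T₁ (ω (free Z))) ∘ T₁ (T₁ (!₁ (η Z)))  ≈⟨ pullʳ (T-resp-∘ Eq.refl) ⟩
      ω (free Z) ∘ T₁ (λ′ Z)                               ∎

    λ′-η : ∀ {Z} → λ′ Z ∘ η (!₀ Z) ≈ !₁ (η Z)
    λ′-η {Z} = begin
      (ω (free Z) ∘ T₁ (!₁ (η Z))) ∘ η _   ≈⟨ pullʳ (Eq.sym η-nat) ⟩
      ω (free Z) ∘ (η _ ∘ !₁ (η Z))        ≈⟨ pullˡ (ω-η {free Z}) ⟩
      id ∘ !₁ (η Z)                        ≈⟨ identityˡ ⟩
      !₁ (η Z)                             ∎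

    λ′-nat : ∀ {Z W} {f : Hom Z W} → !₁ (T₁ f) ∘ λ′ Z ≈ λ′ W ∘ T₁ (!₁ f)
    λ′-nat {Z} {W} {f} = begin
      !₁ (T₁ f) ∘ (ω (free Z) ∘ T₁ (!₁ (η Z)))       ≈⟨ pullˡ (ω-! (free-map f)) ⟩
      (ω (free W) ∘ T₁ (!₁ (T₁ f))) ∘ T₁ (!₁ (η Z))  ≈⟨ pullʳ (T-resp-∘ (!-resp-∘ Eq.refl)) ⟩
      ω (free W) ∘ T₁ (!₁ (T₁ f ∘ η Z))              ≈˘⟨ refl⟩∘⟨ T-resp-∘ (!-resp-∘ η-nat) ⟩
      ω (free W) ∘ (T₁ (!₁ (η W)) ∘ T₁ (!₁ f))       ≈⟨ sym-assoc ⟩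
      λ′ W ∘ T₁ (!₁ f)                               ∎

    λ′-μ : ∀ {Z} → λ′ Z ∘ μ (!₀ Z) ≈ !₁ (μ Z) ∘ λ′ (T₀ Z) ∘ T₁ (λ′ Z)
    λ′-μ {Z} = begin
      λ′ Z ∘ μ (!₀ Z)                                                   ≈⟨ λ′-isAlgHom Z ⟩
      ω (free Z) ∘ T₁ (λ′ Z)                                            ≈˘⟨ refl⟩∘⟨ T!μη-cancel ⟩
      ω (free Z) ∘ (T₁ (!₁ (μ Z)) ∘ (T₁ (!₁ (η (T₀ Z))) ∘ T₁ (λ′ Z)))   ≈⟨ pullˡ (Eq.sym (ω-! (μ-algHom Z))) ⟩
      (!₁ (μ Z) ∘ ω (free (T₀ Z))) ∘ (T₁ (!₁ (η (T₀ Z))) ∘ T₁ (λ′ Z))   ≈⟨ pullʳ sym-assoc ⟩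
      !₁ (μ Z) ∘ λ′ (T₀ Z) ∘ T₁ (λ′ Z)                                  ∎
      where
      T!μη-cancel : T₁ (!₁ (μ Z)) ∘ (T₁ (!₁ (η (T₀ Z))) ∘ T₁ (λ′ Z)) ≈ T₁ (λ′ Z)
      T!μη-cancel = Eq.trans (pullˡ (T-resp-inverse (!-resp-inverse monad-idʳ))) identityˡ

    λ′-δ : ∀ {Z} → δ (T₀ Z) ∘ λ′ Z ≈ !₁ (λ′ Z) ∘ λ′ (!₀ Z) ∘ T₁ (δ Z)
    λ′-δ {Z} = begin
      δ (T₀ Z) ∘ (ω (free Z) ∘ T₁ (!₁ (η Z)))                      ≈⟨ pullˡ (δ-isAlgHom (free Z)) ⟩
      (ω (!ᵀ (free Z)) ∘ T₁ (δ (T₀ Z))) ∘ T₁ (!₁ (η Z))            ≈⟨ pullʳ (T-resp-∘ Eq.refl) ⟩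
      ω (!ᵀ (free Z)) ∘ T₁ (δ (T₀ Z) ∘ !₁ (η Z))                   ≈⟨ refl⟩∘⟨ T-resp-≈ δ!η ⟩
      ω (!ᵀ (free Z)) ∘ T₁ (!₁ (λ′ Z) ∘ (!₁ (η (!₀ Z)) ∘ δ Z))     ≈⟨ refl⟩∘⟨ Eq.trans T-∘ (refl⟩∘⟨ T-∘) ⟩
      ω (!ᵀ (free Z)) ∘ (T₁ (!₁ (λ′ Z)) ∘ (T₁ (!₁ (η (!₀ Z))) ∘ T₁ (δ Z)))
        ≈⟨ pullˡ (Eq.sym (ω-! (λ′ Z , λ′-isAlgHom Z))) ⟩
      (!₁ (λ′ Z) ∘ ω (free (!₀ Z))) ∘ (T₁ (!₁ (η (!₀ Z))) ∘ T₁ (δ Z))  ≈⟨ pullʳ sym-assoc ⟩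
      !₁ (λ′ Z) ∘ λ′ (!₀ Z) ∘ T₁ (δ Z)                             ∎
      where
      δ!η : δ (T₀ Z) ∘ !₁ (η Z) ≈ !₁ (λ′ Z) ∘ (!₁ (η (!₀ Z)) ∘ δ Z)
      δ!η = begin
        δ (T₀ Z) ∘ !₁ (η Z)                  ≈⟨ δ-nat ⟩
        !₁ (!₁ (η Z)) ∘ δ Z                  ≈˘⟨ !-resp-∘ λ′-η ⟩∘⟨refl ⟩
        (!₁ (λ′ Z) ∘ !₁ (η (!₀ Z))) ∘ δ Z    ≈⟨ assoc ⟩
        !₁ (λ′ Z) ∘ (!₁ (η (!₀ Z)) ∘ δ Z)    ∎

    λ′-ε : ∀ {Z} → ε (T₀ Z) ∘ λ′ Z ≈ T₁ (ε Z)
    λ′-ε {Z} = begin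
      ε (T₀ Z) ∘ (ω (free Z) ∘ T₁ (!₁ (η Z)))   ≈⟨ pullˡ (ε-isAlgHom (free Z)) ⟩
      (μ Z ∘ T₁ (ε (T₀ Z))) ∘ T₁ (!₁ (η Z))     ≈⟨ pullʳ (T-resp-∘ Eq.refl) ⟩
      μ Z ∘ T₁ (ε (T₀ Z) ∘ !₁ (η Z))           ≈˘⟨ refl⟩∘⟨ T-resp-∘ (Eq.sym ε-nat) ⟩
      μ Z ∘ (T₁ (η Z) ∘ T₁ (ε Z))              ≈⟨ pullˡ monad-idˡ ⟩
      id ∘ T₁ (ε Z)                            ≈⟨ identityˡ ⟩
      T₁ (ε Z)                                 ∎

    λ′-Δ : ∀ {Z} → Δ (T₀ Z) ∘ λ′ Z ≈ (λ′ Z ⊗₁ λ′ Z) ∘ n (!₀ Z) (!₀ Z) ∘ T₁ (Δ Z)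
    λ′-Δ {Z} = begin
      Δ (T₀ Z) ∘ (ω (free Z) ∘ T₁ (!₁ (η Z)))
        ≈⟨ pullˡ (Δ-isAlgHom (free Z)) ⟩
      (((ω (free Z) ⊗₁ ω (free Z)) ∘ n _ _) ∘ T₁ (Δ (T₀ Z))) ∘ T₁ (!₁ (η Z))
        ≈⟨ pullʳ (T-resp-∘ Eq.refl) ⟩
      ((ω (free Z) ⊗₁ ω (free Z)) ∘ n _ _) ∘ T₁ (Δ (T₀ Z) ∘ !₁ (η Z))
        ≈˘⟨ refl⟩∘⟨ T-resp-∘ (Eq.sym Δ-nat) ⟩
      ((ω (free Z) ⊗₁ ω (free Z)) ∘ n _ _) ∘ (T₁ (!₁ (η Z) ⊗₁ !₁ (η Z)) ∘ T₁ (Δ Z))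
        ≈⟨ pullʳ (pullˡ n-nat) ⟩
      (ω (free Z) ⊗₁ ω (free Z)) ∘ ((T₁ (!₁ (η Z)) ⊗₁ T₁ (!₁ (η Z))) ∘ n _ _) ∘ T₁ (Δ Z)
        ≈⟨ refl⟩∘⟨ assoc ⟩
      (ω (free Z) ⊗₁ ω (free Z)) ∘ ((T₁ (!₁ (η Z)) ⊗₁ T₁ (!₁ (η Z))) ∘ (n _ _ ∘ T₁ (Δ Z)))
        ≈⟨ pullˡ (Eq.sym ⊗-∘) ⟩
      (λ′ Z ⊗₁ λ′ Z) ∘ n (!₀ Z) (!₀ Z) ∘ T₁ (Δ Z)
        ∎

    λ′-𝕖 : ∀ {Z} → 𝕖 (T₀ Z) ∘ λ′ Z ≈ nK ∘ T₁ (𝕖 Z)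
    λ′-𝕖 {Z} = begin
      𝕖 (T₀ Z) ∘ (ω (free Z) ∘ T₁ (!₁ (η Z)))  ≈⟨ pullˡ (𝕖-isAlgHom (free Z)) ⟩
      (nK ∘ T₁ (𝕖 (T₀ Z))) ∘ T₁ (!₁ (η Z))     ≈⟨ pullʳ (T-resp-∘ 𝕖-nat) ⟩
      nK ∘ T₁ (𝕖 Z)                           ∎

    λ′-d : ∀ {Z} → λ′ Z ∘ T₁ (d Z) ≈ d (T₀ Z) ∘ (λ′ Z ⊗₁ id) ∘ n (!₀ Z) Z
    λ′-d {Z} = begin
      (ω (free Z) ∘ T₁ (!₁ (η Z))) ∘ T₁ (d Z)
        ≈⟨ pullʳ (T-resp-∘ Eq.refl) ⟩
      ω (free Z) ∘ T₁ (!₁ (η Z) ∘ d Z)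
        ≈˘⟨ refl⟩∘⟨ T-resp-∘ d-nat ⟩
      ω (free Z) ∘ (T₁ (d (T₀ Z)) ∘ T₁ (!₁ (η Z) ⊗₁ η Z))
        ≈⟨ pullˡ (Eq.sym (d-isAlgHom (free Z))) ⟩
      (d (T₀ Z) ∘ ((ω (free Z) ⊗₁ μ Z) ∘ n _ _)) ∘ T₁ (!₁ (η Z) ⊗₁ η Z)
        ≈⟨ pullʳ (pullʳ n-nat) ⟩
      d (T₀ Z) ∘ ((ω (free Z) ⊗₁ μ Z) ∘ ((T₁ (!₁ (η Z)) ⊗₁ T₁ (η Z)) ∘ n _ _))
        ≈⟨ refl⟩∘⟨ pullˡ (Eq.sym ⊗-∘) ⟩
      d (T₀ Z) ∘ ((λ′ Z ⊗₁ (μ Z ∘ T₁ (η Z))) ∘ n _ _)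
        ≈⟨ refl⟩∘⟨ ⊗-resp-≈ Eq.refl monad-idˡ ⟩∘⟨refl ⟩
      d (T₀ Z) ∘ (λ′ Z ⊗₁ id) ∘ n (!₀ Z) Z
        ∎

    differentialMixedDistributiveLaw : DifferentialMixedDistributiveLaw
    differentialMixedDistributiveLaw = record
      { λ′ = λ′ ; λ-nat = λ′-nat ; λ-μ = λ′-μ ; λ-η = λ′-η ; λ-δ = λ′-δ
      ; λ-ε = λ′-ε ; λ-Δ = λ′-Δ ; λ-𝕖 = λ′-𝕖 ; λ-d = λ′-d }

  liftingToLaw : DifferentialLifting → DifferentialMixedDistributiveLaw
  liftingToLaw = LiftingToLaw.differentialMixedDistributiveLaw

  open Setoid DML-Setoid using () renaming (_≈_ to _≈ᴸ_)
  open Setoid DifferentialLifting-Setoid using () renaming (_≈_ to _≈ᵀ_)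

  lawToLifting-cong : Congruent _≈ᴸ_ _≈ᵀ_ lawToLifting
  lawToLifting-cong p X = refl⟩∘⟨ p (A X)

  liftingToLaw-cong : Congruent _≈ᵀ_ _≈ᴸ_ liftingToLaw
  liftingToLaw-cong p Z = p (free Z) ⟩∘⟨refl

  liftingToLaw-lawToLifting : StrictlyInverseʳ _≈ᴸ_ lawToLifting liftingToLaw
  liftingToLaw-lawToLifting l Z = begin
    (!₁ (μ Z) ∘ λ′ (T₀ Z)) ∘ T₁ (!₁ (η Z))   ≈⟨ pullʳ (Eq.sym λ-nat) ⟩
    !₁ (μ Z) ∘ (!₁ (T₁ (η Z)) ∘ λ′ Z)        ≈⟨ pullˡ (!-resp-inverse monad-idˡ) ⟩
    id ∘ λ′ Z                               ≈⟨ identityˡ ⟩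
    λ′ Z                                    ∎
    where open DifferentialMixedDistributiveLaw l

  lawToLifting-liftingToLaw : StrictlyInverseˡ _≈ᵀ_ lawToLifting liftingToLaw
  lawToLifting-liftingToLaw L X = begin
    !₁ (ν X) ∘ (ω (free (A X)) ∘ T₁ (!₁ (η (A X))))   ≈⟨ pullˡ (ω-! (ν-algHom X)) ⟩
    (ω X ∘ T₁ (!₁ (ν X))) ∘ T₁ (!₁ (η (A X)))         ≈⟨ pullʳ (T-resp-inverse (!-resp-inverse (ν-η X))) ⟩
    ω X ∘ id                                          ≈⟨ identityʳ ⟩
    ω X                                               ∎
    where
    open BangLift (CoalgebraModalityLifting.bangLift (DifferentialLifting.coalgLift L))

  lawToLifting-inverseˡ : Inverseˡ _≈ᴸ_ _≈ᵀ_ lawToLifting liftingToLaw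
  lawToLifting-inverseˡ {L} {l} p X =
    Eq.trans (lawToLifting-cong {l} {liftingToLaw L} p X) (lawToLifting-liftingToLaw L X)

  liftingToLaw-inverseʳ : Inverseʳ _≈ᴸ_ _≈ᵀ_ lawToLifting liftingToLaw
  liftingToLaw-inverseʳ {l} {L} p Z =
    Eq.trans (liftingToLaw-cong {L} {lawToLifting l} p Z) (liftingToLaw-lawToLifting l Z)

proposition7p11 : ∀ {o h e} (𝔻 : DifferentialCategory o h e)
    (𝕋 : AdditiveSymComonoidalMonad (DifferentialCategory.asmc 𝔻)) →
    Inverse (Liftings.DML-Setoid 𝔻 𝕋) (Liftings.DifferentialLifting-Setoid 𝔻 𝕋)
-- The setoid equalities only mention projections of laws and liftings, so Agda cannot
-- infer the implicit arguments of the lemmas below; they are passed on explicitly.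
proposition7p11 𝔻 𝕋 = record
  { to        = lawToLifting
  ; from      = liftingToLaw
  ; to-cong   = λ {l l′} → lawToLifting-cong {l} {l′}
  ; from-cong = λ {L L′} → liftingToLaw-cong {L} {L′}
  ; inverse   = (λ {L l} → lawToLifting-inverseˡ {L} {l}) , (λ {l L} → liftingToLaw-inverseʳ {l} {L})
  }
  where open Correspondence 𝔻 𝕋
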